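{- $\mathcal{P}(\Box\!\!\rightarrow) <\mathcal{PCO}$.
   Context: Logics are evaluated on causal multiteams (finite multisets of assignments over a finite signature together with recursive structural equations). $\mathcal{PCO}$ is built from $\mathcal{CO}$ literals and probabilistic atoms $\Pr(\alpha)\geq\epsilon$, $\Pr(\alpha)>\epsilon$, $\Pr(\alpha)\geq\Pr(\beta)$, $\Pr(\alpha)>\Pr(\beta)$, closed under $\land$, global disjunction $\sqcup$, selective implication $\alpha\supset\varphi$ and interventionist counterfactual $\mathbf X=\mathbf x\,\Box\!\!\rightarrow\varphi$; $\mathcal{P}(\Box\!\!\rightarrow)$ is its fragment without $\supset$. $\mathcal L<\mathcal L'$ means every formula of $\mathcal L$ is equivalent to one of $\mathcal L'$ but not vice versa. -}

module Defs where

open import Data.Nat using (ℕ; zero; suc)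
open import Data.Fin using (Fin)
import Data.Fin as Fin
open import Data.Bool using (Bool; true; false; if_then_else_; _∧_; _∨_; not)
open import Data.Maybe using (Maybe; just; nothing)
open import Data.List using (List; []; _∷_; length; map)
open import Data.List.Membership.Propositional using (_∈_)
open import Data.Product using (Σ; _×_; _,_; proj₁)
open import Data.Sum using (_⊎_)
open import Data.Unit using (⊤)
open import Data.Empty using (⊥)
open import Relation.Nullary using (¬_)
open import Relation.Nullary.Decidable using (⌊_⌋)
open import Relation.Binary.PropositionalEquality using (_≡_)
open import Data.Rational using (ℚ; _/_; 0ℚ; 1ℚ)
import Data.Rational as ℚ
open import Data.Integer using (+_)

record Signature : Set where
  field
    nvar : ℕ
    size : Fin nvar → ℕ

module _ {σ : Signature} where
  open Signature σ

  Var : Set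
  Var = Fin nvar

  Ran : Var → Set
  Ran V = Fin (suc (size V))

Var′ : Signature → Set
Var′ σ = Var {σ}

Ran′ : (σ : Signature) → Var′ σ → Set
Ran′ σ V = Ran {σ} V

Assignment : Signature → Set
Assignment σ = (V : Var′ σ) → Ran′ σ V

-- Structural equations F: a set of endogenous variables (End), for each
-- variable V its parent set PA V (W ∈ PA V iff PA V W ≡ true), and for
-- endogenous V a function F_V : Ran(PA_V) → Ran(V).

record Equations (σ : Signature) : Set where
  field
    End : Var′ σ → Bool
    PA  : Var′ σ → Var′ σ → Bool
    fn  : (V : Var′ σ) → ((W : Var′ σ) → PA V W ≡ true → Ran′ σ W) → Ran′ σ V
open Equations public

-- A (raw) causal multiteam: a finite multiset of assignments (a list;
-- multiplicities matter, order is irrelevant for the semantics) + equations.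
record CausalMultiteam (σ : Signature) : Set where
  constructor ⟨_,_⟩
  field
    team : List (Assignment σ)
    eqs  : Equations σ
open CausalMultiteam public

Edge : {σ : Signature} → Equations σ → Var′ σ → Var′ σ → Set
Edge F W V = (End F V ≡ true) × (PA F V W ≡ true)

data Path {σ : Signature} (F : Equations σ) : Var′ σ → Var′ σ → Set where
  edge : ∀ {W V} → Edge F W V → Path F W V
  _then_ : ∀ {U W V} → Path F U W → Path F W V → Path F U V

Recursive : {σ : Signature} → Equations σ → Set
Recursive {σ} F = (V : Var′ σ) → ¬ Path F V V

Compatible : {σ : Signature} → CausalMultiteam σ → Set
Compatible {σ} T =
  (s : Assignment σ) → s ∈ team T → (V : Var′ σ) → End (eqs T) V ≡ true →
  s V ≡ fn (eqs T) V (λ W _ → s W)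

IsCausal : {σ : Signature} → CausalMultiteam σ → Set
IsCausal T = Recursive (eqs T) × Compatible T

-- Interventions X = x, represented as a consistent partial assignment
-- (X V ≡ just x  iff  V ∈ X with value x).

Intervention : Signature → Set
Intervention σ = (V : Var′ σ) → Maybe (Ran′ σ V)

intervEqs : {σ : Signature} → Intervention σ → Equations σ → Equations σ
intervEqs X F = record
  { End = λ V → isNothing (X V) ∧ End F V
  ; PA  = PA F
  ; fn  = fn F }
  where
  isNothing : ∀ {A : Set} → Maybe A → Bool
  isNothing (just _) = false
  isNothing nothing  = true

updateStep : {σ : Signature} → Intervention σ → Equations σ → Assignment σ → Assignment σ
updateStep X F s V with X V
... | just x  = x
... | nothing = if End F V then fn F V (λ W _ → s W) else s V

iterateN : {A : Set} → ℕ → (A → A) → A → A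
iterateN zero    f a = a
iterateN (suc k) f a = f (iterateN k f a)

-- s_{X=x}: the solution of F_{X=x} agreeing with s on the exogenous
-- variables and with x on X; for a recursive system over nvar variables
-- nvar update rounds reach this (unique) solution.
intervAssign : {σ : Signature} → Intervention σ → Equations σ → Assignment σ → Assignment σ
intervAssign {σ} X F s = iterateN (Signature.nvar σ) (updateStep X F) s

intervene : {σ : Signature} → Intervention σ → CausalMultiteam σ → CausalMultiteam σ
intervene X T = ⟨ map (intervAssign X (eqs T)) (team T) , intervEqs X (eqs T) ⟩

data CO (σ : Signature) : Set where
  eq  : (V : Var′ σ) → Ran′ σ V → CO σ
  neq : (V : Var′ σ) → Ran′ σ V → CO σ
  _∧ᶜ_ : CO σ → CO σ → CO σ
  _∨ᶜ_ : CO σ → CO σ → CO σ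
  _□→ᶜ_ : Intervention σ → CO σ → CO σ

evalCO : {σ : Signature} → Equations σ → Assignment σ → CO σ → Bool
evalCO F s (eq V v)  = ⌊ s V Fin.≟ v ⌋
evalCO F s (neq V v) = not ⌊ s V Fin.≟ v ⌋
evalCO F s (α ∧ᶜ β)  = evalCO F s α ∧ evalCO F s β
evalCO F s (α ∨ᶜ β)  = evalCO F s α ∨ evalCO F s β
evalCO F s (X □→ᶜ α) = evalCO (intervEqs X F) (intervAssign X F s) α

select : {A : Set} → (A → Bool) → List A → List A
select p [] = []
select p (a ∷ as) = if p a then a ∷ select p as else select p as

restrict : {σ : Signature} → CO σ → CausalMultiteam σ → CausalMultiteam σ
restrict α T = ⟨ select (λ s → evalCO (eqs T) s α) (team T) , eqs T ⟩

-- P_T(α) = |T^α| / |T|  (only used for non-empty T)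
prob : {σ : Signature} → Equations σ → List (Assignment σ) → CO σ → ℚ
prob F [] α = 0ℚ
prob F (s ∷ ss) α = (+ length (select (λ t → evalCO F t α) (s ∷ ss))) / suc (length ss)

ifNonEmpty : {A : Set} → List A → Set → Set
ifNonEmpty [] P = ⊤
ifNonEmpty (_ ∷ _) P = P

data PCO (σ : Signature) : Set where
  eqˡ  : (V : Var′ σ) → Ran′ σ V → PCO σ
  neqˡ : (V : Var′ σ) → Ran′ σ V → PCO σ
  Pr≥ : CO σ → (ε : ℚ) → 0ℚ ℚ.≤ ε → ε ℚ.≤ 1ℚ → PCO σ
  Pr> : CO σ → (ε : ℚ) → 0ℚ ℚ.≤ ε → ε ℚ.≤ 1ℚ → PCO σ
  Pr≥Pr : CO σ → CO σ → PCO σ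
  Pr>Pr : CO σ → CO σ → PCO σ
  _∧ᵖ_ : PCO σ → PCO σ → PCO σ
  _⊔_  : PCO σ → PCO σ → PCO σ
  _⊃_  : CO σ → PCO σ → PCO σ
  _□→_ : Intervention σ → PCO σ → PCO σ

infix 4 _⊨_
_⊨_ : {σ : Signature} → CausalMultiteam σ → PCO σ → Set
T ⊨ eqˡ V v  = ∀ s → s ∈ team T → s V ≡ v
T ⊨ neqˡ V v = ∀ s → s ∈ team T → ¬ (s V ≡ v)
T ⊨ Pr≥ α ε _ _ = ifNonEmpty (team T) (ε ℚ.≤ prob (eqs T) (team T) α)
T ⊨ Pr> α ε _ _ = ifNonEmpty (team T) (ε ℚ.< prob (eqs T) (team T) α)
T ⊨ Pr≥Pr α β = ifNonEmpty (team T) (prob (eqs T) (team T) β ℚ.≤ prob (eqs T) (team T) α)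
T ⊨ Pr>Pr α β = ifNonEmpty (team T) (prob (eqs T) (team T) β ℚ.< prob (eqs T) (team T) α)
T ⊨ (φ ∧ᵖ ψ) = (T ⊨ φ) × (T ⊨ ψ)
T ⊨ (φ ⊔ ψ)  = (T ⊨ φ) ⊎ (T ⊨ ψ)
T ⊨ (α ⊃ φ)  = restrict α T ⊨ φ
T ⊨ (X □→ φ) = intervene X T ⊨ φ

NoSel : {σ : Signature} → PCO σ → Set
NoSel (φ ∧ᵖ ψ) = NoSel φ × NoSel ψ
NoSel (φ ⊔ ψ)  = NoSel φ × NoSel ψ
NoSel (α ⊃ φ)  = ⊥
NoSel (X □→ φ) = NoSel φ
NoSel _ = ⊤

Fragment : Set₁
Fragment = (σ : Signature) → PCO σ → Set

PCOᴸ : Fragment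
PCOᴸ σ φ = ⊤

P□→ᴸ : Fragment
P□→ᴸ σ φ = NoSel φ

_≡ᶠ_ : {σ : Signature} → PCO σ → PCO σ → Set
_≡ᶠ_ {σ} φ ψ = (T : CausalMultiteam σ) → IsCausal T → ((T ⊨ φ) → (T ⊨ ψ)) × ((T ⊨ ψ) → (T ⊨ φ))

_≤ᴸ_ : Fragment → Fragment → Set
L ≤ᴸ L′ = (σ : Signature) (φ : PCO σ) → L σ φ → Σ (PCO σ) (λ ψ → L′ σ ψ × (φ ≡ᶠ ψ))

_<ᴸ_ : Fragment → Fragment → Set
L <ᴸ L′ = (L ≤ᴸ L′) × ¬ (L′ ≤ᴸ L)

module Submission where

-- Take one variable with values w₀, w₁, w₂ and no equations, and the teams
-- A k = {w₀, w₁, w₁} + k·{w₂} and B k = {w₀, w₁, w₁, w₁} + k·{w₂}.  The PCO formula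
-- (X ≠ w₂) ⊃ Pr(X = w₀) ≥ 1/3 holds in every A k and fails in every B k.
-- Without ⊃, on the other hand, every formula true in A k is true in B k once k is
-- large.  An intervention either does nothing or makes the team constant, and the
-- size of a constant team is invisible.  The probability of α is (a + c k)/(3 + k) in
-- A k and (stretch a + c k)/(4 + k) in B k, with a ≤ 3 and c ∈ {0, 1}; for large k
-- comparisons between such fractions, or with a fixed threshold p/q, are decided by
-- the base-k numerals a + c k, whose order the monotone map stretch preserves.

open import Defs

open import Data.Bool using (Bool; true; false; if_then_else_; _∧_; _∨_; not)
open import Data.Empty using (⊥-elim)
open import Data.Fin using (Fin; zero; suc)
import Data.Fin as Fin
open import Data.Integer using (+_; -[1+_])
import Data.Integer as ℤ
import Data.Integer.Properties as ℤP
open import Data.List using (List; []; _∷_; [_]; _++_; length; map; replicate)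
open import Data.List.Membership.Propositional using (_∈_)
open import Data.List.Membership.Propositional.Properties using (∈-map⁺; ∈-map⁻)
open import Data.List.Properties using (length-map; length-++; length-replicate; map-replicate; map-cong; map-id; map-∘)
open import Data.List.Relation.Unary.Any using (here; there)
import Data.List.Relation.Unary.All as All
open import Data.List.Relation.Unary.All.Properties using (replicate⁺)
open import Data.Maybe using (just; nothing; fromMaybe)
import Data.Nat as ℕ
open import Data.Nat using (ℕ; zero; suc; _+_; _*_; _≤_; _<_; z≤n; s≤s; ⌊_/2⌋; NonZero)
open import Data.Nat.Properties
open import Data.Product using (∃-syntax; _×_; _,_; proj₁; proj₂)
open import Data.Product.Function.NonDependent.Propositional using (_×-⇔_)
open import Data.Rational using (ℚ; mkℚ; _/_; 0ℚ)
import Data.Rational as ℚ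
import Data.Rational.Properties as ℚP
open import Data.Rational.Unnormalised using (mkℚᵘ)
import Data.Rational.Unnormalised as ℚᵘ
import Data.Rational.Unnormalised.Properties as ℚᵘP
open import Data.Sum using (_⊎_; inj₁; inj₂)
import Data.Sum as Sum
open import Data.Sum.Function.Propositional using (_⊎-⇔_)
open import Data.Unit using (tt)
open import Function using (_∘_; id; const; _⇔_; mk⇔; Equivalence)
open import Function.Construct.Composition using (_⇔-∘_)
open import Function.Construct.Identity using (⇔-id)
open import Function.Construct.Symmetry using (⇔-sym)
open import Relation.Nullary using (¬_)
open import Relation.Nullary.Decidable using (⌊_⌋)
open import Relation.Binary.PropositionalEquality
  using (_≡_; refl; sym; trans; cong; cong₂; subst; subst₂; module ≡-Reasoning)

open Equivalence using (to; from)

high-digit-dominates : ∀ {a a′ c c′ k} → a < k → c < c′ → a + c * k < a′ + c′ * k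
high-digit-dominates {a} {a′} {c} {c′} {k} a<k c<c′ = begin-strict
  a + c * k   <⟨ +-monoˡ-< (c * k) a<k ⟩
  suc c * k   ≤⟨ *-monoˡ-≤ k c<c′ ⟩
  c′ * k      ≤⟨ m≤n+m (c′ * k) a′ ⟩
  a′ + c′ * k ∎
  where open ≤-Reasoning

high-digit-mono : ∀ {a a′ c c′ k} → a′ < k → a + c * k ≤ a′ + c′ * k → c ≤ c′
high-digit-mono a′<k h = ≮⇒≥ (λ c′<c → <⇒≱ (high-digit-dominates a′<k c′<c) h)

digits-≤-transfer : ∀ {a a′ b b′ c c′ k} → a′ < k → b < k → (c ≡ c′ → a ≤ a′ → b ≤ b′) →
                    a + c * k ≤ a′ + c′ * k → b + c * k ≤ b′ + c′ * k
digits-≤-transfer {a} {a′} {c = c} {c′} {k} a′<k b<k low-mono h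
  with m≤n⇒m<n∨m≡n (high-digit-mono {a} {a′} {c} {c′} a′<k h)
... | inj₁ c<c′ = <⇒≤ (high-digit-dominates b<k c<c′)
... | inj₂ refl = +-monoˡ-≤ (c * k) (low-mono refl (+-cancelʳ-≤ (c * k) a a′ h))

digits-<-transfer : ∀ {a a′ b b′ c c′ k} → a′ < k → b < k → (c ≡ c′ → a < a′ → b < b′) →
                    a + c * k < a′ + c′ * k → b + c * k < b′ + c′ * k
digits-<-transfer {a} {a′} {c = c} {c′} {k} a′<k b<k low-mono h
  with m≤n⇒m<n∨m≡n (high-digit-mono {a} {a′} {c} {c′} a′<k (<⇒≤ h))
... | inj₁ c<c′ = high-digit-dominates b<k c<c′
... | inj₂ refl = +-monoˡ-< (c * k) (low-mono refl (+-cancelʳ-< (c * k) a a′ h))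

two-digit-*ʳ : ∀ a c k q → (a + c * k) * q ≡ a * q + c * q * k
two-digit-*ʳ a c k q = trans (*-distribʳ-+ q a (c * k)) (cong (_+_ (a * q)) (begin
  c * k * q   ≡⟨ *-assoc c k q ⟩
  c * (k * q) ≡⟨ cong (c *_) (*-comm k q) ⟩
  c * (q * k) ≡⟨ *-assoc c q k ⟨
  c * q * k   ∎))
  where open ≡-Reasoning

toℚᵘ-/ : ∀ a m → ℚ.toℚᵘ (+ a / suc m) ℚᵘ.≃ mkℚᵘ (+ a) m
toℚᵘ-/ a m = ℚP.toℚᵘ-fromℚᵘ (mkℚᵘ (+ a) m)

/≤/⇔ : ∀ a m b n → (+ a / suc m ℚ.≤ + b / suc n) ⇔ (a * suc n ≤ b * suc m)
/≤/⇔ a m b n = mk⇔ cross uncross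
  where
  cross : + a / suc m ℚ.≤ + b / suc n → a * suc n ≤ b * suc m
  cross h with ℚᵘP.≤-respʳ-≃ (toℚᵘ-/ b n) (ℚᵘP.≤-respˡ-≃ (toℚᵘ-/ a m) (ℚP.toℚᵘ-mono-≤ h))
  ... | ℚᵘ.*≤* h′ =
    ℤP.drop‿+≤+ (subst₂ ℤ._≤_ (sym (ℤP.pos-* a (suc n))) (sym (ℤP.pos-* b (suc m))) h′)
  uncross : a * suc n ≤ b * suc m → + a / suc m ℚ.≤ + b / suc n
  uncross h = ℚP.toℚᵘ-cancel-≤
    (ℚᵘP.≤-respʳ-≃ (ℚᵘP.≃-sym (toℚᵘ-/ b n)) (ℚᵘP.≤-respˡ-≃ (ℚᵘP.≃-sym (toℚᵘ-/ a m))
    (ℚᵘ.*≤* (subst₂ ℤ._≤_ (ℤP.pos-* a (suc n)) (ℤP.pos-* b (suc m)) (ℤ.+≤+ h)))))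

/</⇔ : ∀ a m b n → (+ a / suc m ℚ.< + b / suc n) ⇔ (a * suc n < b * suc m)
/</⇔ a m b n = mk⇔ cross uncross
  where
  cross : + a / suc m ℚ.< + b / suc n → a * suc n < b * suc m
  cross h with ℚᵘP.<-respʳ-≃ (toℚᵘ-/ b n) (ℚᵘP.<-respˡ-≃ (toℚᵘ-/ a m) (ℚP.toℚᵘ-mono-< h))
  ... | ℚᵘ.*<* h′ =
    ℤP.drop‿+<+ (subst₂ ℤ._<_ (sym (ℤP.pos-* a (suc n))) (sym (ℤP.pos-* b (suc m))) h′)
  uncross : a * suc n < b * suc m → + a / suc m ℚ.< + b / suc n
  uncross h = ℚP.toℚᵘ-cancel-<
    (ℚᵘP.<-respʳ-≃ (ℚᵘP.≃-sym (toℚᵘ-/ b n)) (ℚᵘP.<-respˡ-≃ (ℚᵘP.≃-sym (toℚᵘ-/ a m))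
    (ℚᵘ.*<* (subst₂ ℤ._<_ (ℤP.pos-* a (suc n)) (ℤP.pos-* b (suc m)) (ℤ.+<+ h)))))

/-scale : ∀ c m → + (c * suc m) / suc m ≡ + c / 1
/-scale c m = ℚP.≤-antisym (from (/≤/⇔ (c * suc m) m c 0) (≤-reflexive (*-identityʳ (c * suc m))))
                           (from (/≤/⇔ c 0 (c * suc m) m) (≤-reflexive (sym (*-identityʳ (c * suc m)))))

module _ {A : Set} where

  length-select-++ : ∀ (p : A → Bool) xs ys →
                     length (select p (xs ++ ys)) ≡ length (select p xs) + length (select p ys)
  length-select-++ p []       ys = refl
  length-select-++ p (x ∷ xs) ys with p x
  ... | true  = cong suc (length-select-++ p xs ys)
  ... | false = length-select-++ p xs ys

  select-replicate : ∀ (p : A → Bool) k x →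
                     select p (replicate k x) ≡ (if p x then replicate k x else [])
  select-replicate p zero    x with p x
  ... | true  = refl
  ... | false = refl
  select-replicate p (suc k) x with p x in px
  ... | true  = cong (x ∷_) (trans (select-replicate p k x) (cong (λ b → if b then replicate k x else []) px))
  ... | false = trans (select-replicate p k x) (cong (λ b → if b then replicate k x else []) px)

  length-select-replicate : ∀ (p : A → Bool) k x →
                            length (select p (replicate k x)) ≡ length (select p [ x ]) * k
  length-select-replicate p k x rewrite select-replicate p k x with p x
  ... | true  = trans (length-replicate k) (sym (+-identityʳ k))
  ... | false = refl

  length-select-≤ : ∀ (p : A → Bool) xs → length (select p xs) ≤ length xs
  length-select-≤ p []       = z≤n
  length-select-≤ p (x ∷ xs) with p x
  ... | true  = s≤s (length-select-≤ p xs)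
  ... | false = m≤n⇒m≤1+n (length-select-≤ p xs)

  select-map : ∀ {B : Set} (f : A → B) {p : A → Bool} {q : B → Bool} → (∀ a → p a ≡ q (f a)) →
               ∀ xs → map f (select p xs) ≡ select q (map f xs)
  select-map f         p≗q∘f []       = refl
  select-map f {p} {q} p≗q∘f (x ∷ xs) rewrite p≗q∘f x with q (f x)
  ... | true  = cong (f x ∷_) (select-map f p≗q∘f xs)
  ... | false = select-map f p≗q∘f xs

  map-const : ∀ {B : Set} (y : B) (xs : List A) → map (const y) xs ≡ replicate (length xs) y
  map-const y []       = refl
  map-const y (x ∷ xs) = cong (y ∷_) (map-const y xs)

  ∀∈-map : ∀ {B : Set} {f : A → B} {P : B → Set} {xs} →
           (∀ x → x ∈ xs → P (f x)) ⇔ (∀ y → y ∈ map f xs → P y)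
  ∀∈-map {f = f} {P} = mk⇔
    (λ h y y∈ → let (x , x∈ , y≡fx) = ∈-map⁻ f y∈ in subst P (sym y≡fx) (h x x∈))
    (λ h x x∈ → h (f x) (∈-map⁺ f x∈))

  ∀∈-replicate : ∀ {P : A → Set} {x} m n →
                 (∀ y → y ∈ replicate (suc m) x → P y) → (∀ y → y ∈ replicate (suc n) x → P y)
  ∀∈-replicate m n h y y∈ = All.lookup (replicate⁺ (suc n) (h _ (here refl))) y∈

Eventually : (ℕ → Set) → Set
Eventually P = ∃[ K ] (∀ {k} → K ≤ k → P k)

eventually-map : ∀ {P Q : ℕ → Set} → (∀ {k} → P k → Q k) → Eventually P → Eventually Q
eventually-map f (K , p) = K , f ∘ p

eventually-× : ∀ {P Q : ℕ → Set} → Eventually P → Eventually Q → Eventually (λ k → P k × Q k)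
eventually-× (K , p) (L , q) =
  K ℕ.⊔ L , λ K⊔L≤k → p (m⊔n≤o⇒m≤o K L K⊔L≤k) , q (m⊔n≤o⇒n≤o K L K⊔L≤k)

-- Teams over a single exogenous variable are multisets of values

module OneVariable (n : ℕ) where

  σ₁ : Signature
  σ₁ = record { nvar = 1 ; size = λ _ → n }

  Val : Set
  Val = Fin (suc n)

  value : Assignment σ₁ → Val
  value s = s zero

  update : Intervention σ₁ → Val → Val
  update X w = fromMaybe w (X zero)

  ⟦_⟧ : CO σ₁ → Val → Bool
  ⟦ eq zero v ⟧     w = ⌊ w Fin.≟ v ⌋
  ⟦ neq zero v ⟧    w = not ⌊ w Fin.≟ v ⌋
  ⟦ α ∧ᶜ β ⟧        w = ⟦ α ⟧ w ∧ ⟦ β ⟧ w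
  ⟦ α ∨ᶜ β ⟧        w = ⟦ α ⟧ w ∨ ⟦ β ⟧ w
  ⟦ X □→ᶜ α ⟧       w = ⟦ α ⟧ (update X w)

  count : CO σ₁ → List Val → ℕ
  count α ws = length (select ⟦ α ⟧ ws)

  probᵛ : List Val → CO σ₁ → ℚ
  probᵛ []       α = 0ℚ
  probᵛ (w ∷ ws) α = + count α (w ∷ ws) / suc (length ws)

  infix 4 _⊨ᵛ_
  _⊨ᵛ_ : List Val → PCO σ₁ → Set
  ws ⊨ᵛ eqˡ zero v    = ∀ w → w ∈ ws → w ≡ v
  ws ⊨ᵛ neqˡ zero v   = ∀ w → w ∈ ws → ¬ (w ≡ v)
  ws ⊨ᵛ Pr≥ α ε _ _   = ifNonEmpty ws (ε ℚ.≤ probᵛ ws α)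
  ws ⊨ᵛ Pr> α ε _ _   = ifNonEmpty ws (ε ℚ.< probᵛ ws α)
  ws ⊨ᵛ Pr≥Pr α β     = ifNonEmpty ws (probᵛ ws β ℚ.≤ probᵛ ws α)
  ws ⊨ᵛ Pr>Pr α β     = ifNonEmpty ws (probᵛ ws β ℚ.< probᵛ ws α)
  ws ⊨ᵛ (φ ∧ᵖ ψ)      = (ws ⊨ᵛ φ) × (ws ⊨ᵛ ψ)
  ws ⊨ᵛ (φ ⊔ ψ)       = (ws ⊨ᵛ φ) ⊎ (ws ⊨ᵛ ψ)
  ws ⊨ᵛ (α ⊃ φ)       = select ⟦ α ⟧ ws ⊨ᵛ φ
  ws ⊨ᵛ (X □→ φ)      = map (update X) ws ⊨ᵛ φ

  -- A record rather than the bare equation, so that F can be inferred from a proof.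
  record Exogenous (F : Equations σ₁) : Set where
    constructor exogenous
    field not-endogenous : End F zero ≡ false

  intervEqs-exogenous : ∀ X {F} → Exogenous F → Exogenous (intervEqs X F)
  intervEqs-exogenous X {F} (exogenous e) = exogenous intervened-not-endogenous
    where
    intervened-not-endogenous : End (intervEqs X F) zero ≡ false
    intervened-not-endogenous with X zero
    ... | just _  = refl
    ... | nothing = e

  intervAssign-value : ∀ X {F} → Exogenous F → ∀ s → value (intervAssign X F s) ≡ update X (value s)
  intervAssign-value X (exogenous e) s with X zero
  ... | just _  = refl
  ... | nothing rewrite e = refl

  evalCO-value : ∀ {F} → Exogenous F → ∀ α s → evalCO F s α ≡ ⟦ α ⟧ (value s)
  evalCO-value e (eq zero v)  s = refl
  evalCO-value e (neq zero v) s = refl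
  evalCO-value e (α ∧ᶜ β)     s = cong₂ _∧_ (evalCO-value e α s) (evalCO-value e β s)
  evalCO-value e (α ∨ᶜ β)     s = cong₂ _∨_ (evalCO-value e α s) (evalCO-value e β s)
  evalCO-value e (X □→ᶜ α)    s =
    trans (evalCO-value (intervEqs-exogenous X e) α _) (cong ⟦ α ⟧ (intervAssign-value X e s))

  select-value : ∀ {F} → Exogenous F → ∀ α ss →
                 map value (select (λ s → evalCO F s α) ss) ≡ select ⟦ α ⟧ (map value ss)
  select-value e α = select-map value (evalCO-value e α)

  intervene-value : ∀ X {F} → Exogenous F → ∀ ss →
                    map value (map (intervAssign X F) ss) ≡ map (update X) (map value ss)
  intervene-value X e ss = trans (sym (map-∘ ss)) (trans (map-cong (intervAssign-value X e) ss) (map-∘ ss))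

  prob-value : ∀ {F} → Exogenous F → ∀ α ss → prob F ss α ≡ probᵛ (map value ss) α
  prob-value e α []       = refl
  prob-value {F} e α (s ∷ ss) = ℚP./-cong
    (cong +_ (trans (sym (length-map value (select (λ t → evalCO F t α) (s ∷ ss))))
                    (cong length (select-value e α (s ∷ ss)))))
    (cong suc (sym (length-map value ss)))

  prob-atom-value : ∀ {F} → Exogenous F → (R : ℚ → ℚ → Set) → ∀ β α ss →
                    ifNonEmpty ss (R (prob F ss β) (prob F ss α)) ⇔
                    ifNonEmpty (map value ss) (R (probᵛ (map value ss) β) (probᵛ (map value ss) α))
  prob-atom-value e R β α []       = ⇔-id _
  prob-atom-value {F} e R β α (s ∷ ss) =
    subst₂ (λ x y → R (prob F (s ∷ ss) β) (prob F (s ∷ ss) α) ⇔ R x y)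
      (prob-value e β (s ∷ ss)) (prob-value e α (s ∷ ss)) (⇔-id _)

  ⊨⇔⊨ᵛ : ∀ {F} → Exogenous F → ∀ ψ ss → ⟨ ss , F ⟩ ⊨ ψ ⇔ map value ss ⊨ᵛ ψ
  ⊨⇔⊨ᵛ e (eqˡ zero v)   ss = ∀∈-map
  ⊨⇔⊨ᵛ e (neqˡ zero v)  ss = ∀∈-map
  ⊨⇔⊨ᵛ e (Pr≥ α ε _ _)  ss = prob-atom-value e (λ _ p → ε ℚ.≤ p) α α ss
  ⊨⇔⊨ᵛ e (Pr> α ε _ _)  ss = prob-atom-value e (λ _ p → ε ℚ.< p) α α ss
  ⊨⇔⊨ᵛ e (Pr≥Pr α β)    ss = prob-atom-value e ℚ._≤_ β α ss
  ⊨⇔⊨ᵛ e (Pr>Pr α β)    ss = prob-atom-value e ℚ._<_ β α ss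
  ⊨⇔⊨ᵛ e (φ ∧ᵖ ψ)       ss = ⊨⇔⊨ᵛ e φ ss ×-⇔ ⊨⇔⊨ᵛ e ψ ss
  ⊨⇔⊨ᵛ e (φ ⊔ ψ)        ss = ⊨⇔⊨ᵛ e φ ss ⊎-⇔ ⊨⇔⊨ᵛ e ψ ss
  ⊨⇔⊨ᵛ {F} e (α ⊃ φ)    ss =
    subst (λ ws → restrict α ⟨ ss , F ⟩ ⊨ φ ⇔ ws ⊨ᵛ φ) (select-value e α ss) (⊨⇔⊨ᵛ e φ _)
  ⊨⇔⊨ᵛ {F} e (X □→ φ)    ss =
    subst (λ ws → intervene X ⟨ ss , F ⟩ ⊨ φ ⇔ ws ⊨ᵛ φ) (intervene-value X e ss)
      (⊨⇔⊨ᵛ (intervEqs-exogenous X e) φ _)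

  F₀ : Equations σ₁
  F₀ = record { End = λ _ → false ; PA = λ _ _ → false ; fn = λ _ _ → zero }

  assign : Val → Assignment σ₁
  assign w zero = w

  F₀-acyclic : ∀ {U W} → ¬ Path F₀ U W
  F₀-acyclic (edge (() , _))
  F₀-acyclic (p then _) = F₀-acyclic p

  assign-causal : ∀ ws → IsCausal ⟨ map assign ws , F₀ ⟩
  assign-causal ws = (λ _ → F₀-acyclic) , (λ _ _ _ ())

  value-assign : ∀ ws → map value (map assign ws) ≡ ws
  value-assign ws = trans (sym (map-∘ ws)) (map-id ws)

  ≡ᶠ⇒⊨ᵛ⇔ : ∀ {φ ψ : PCO σ₁} → φ ≡ᶠ ψ → ∀ ws → ws ⊨ᵛ φ ⇔ ws ⊨ᵛ ψ
  ≡ᶠ⇒⊨ᵛ⇔ {φ} {ψ} φ≡ψ ws = subst (λ vs → vs ⊨ᵛ φ ⇔ vs ⊨ᵛ ψ) (value-assign ws)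
    (⊨⇔⊨ᵛ (exogenous refl) ψ _ ⇔-∘
      (mk⇔ (proj₁ φ⇔ψ) (proj₂ φ⇔ψ) ⇔-∘ ⇔-sym (⊨⇔⊨ᵛ (exogenous refl) φ _)))
    where φ⇔ψ = φ≡ψ ⟨ map assign ws , F₀ ⟩ (assign-causal ws)

  probᵛ-replicate : ∀ α x m n → probᵛ (replicate (suc m) x) α ≡ probᵛ (replicate (suc n) x) α
  probᵛ-replicate α x m n = trans (singleton m) (sym (singleton n))
    where
    singleton : ∀ m → probᵛ (replicate (suc m) x) α ≡ probᵛ [ x ] α
    singleton m = trans
      (ℚP./-cong (cong +_ (length-select-replicate ⟦ α ⟧ (suc m) x)) (cong suc (length-replicate m)))
      (/-scale (count α [ x ]) m)

  replicate-⊨ᵛ : ∀ ψ x m n → replicate (suc m) x ⊨ᵛ ψ → replicate (suc n) x ⊨ᵛ ψ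
  replicate-⊨ᵛ (eqˡ zero v)  x m n = ∀∈-replicate m n
  replicate-⊨ᵛ (neqˡ zero v) x m n = ∀∈-replicate m n
  replicate-⊨ᵛ (Pr≥ α ε _ _) x m n = subst (ε ℚ.≤_) (probᵛ-replicate α x m n)
  replicate-⊨ᵛ (Pr> α ε _ _) x m n = subst (ε ℚ.<_) (probᵛ-replicate α x m n)
  replicate-⊨ᵛ (Pr≥Pr α β)   x m n = subst₂ ℚ._≤_ (probᵛ-replicate β x m n) (probᵛ-replicate α x m n)
  replicate-⊨ᵛ (Pr>Pr α β)   x m n = subst₂ ℚ._<_ (probᵛ-replicate β x m n) (probᵛ-replicate α x m n)
  replicate-⊨ᵛ (φ ∧ᵖ ψ)      x m n (hφ , hψ) = replicate-⊨ᵛ φ x m n hφ , replicate-⊨ᵛ ψ x m n hψ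
  replicate-⊨ᵛ (φ ⊔ ψ)       x m n = Sum.map (replicate-⊨ᵛ φ x m n) (replicate-⊨ᵛ ψ x m n)
  replicate-⊨ᵛ (α ⊃ φ)       x m n h =
    subst (_⊨ᵛ φ) (sym (select-replicate ⟦ α ⟧ (suc n) x))
      (selected (⟦ α ⟧ x) (subst (_⊨ᵛ φ) (select-replicate ⟦ α ⟧ (suc m) x) h))
    where
    selected : ∀ b → (if b then replicate (suc m) x else []) ⊨ᵛ φ → (if b then replicate (suc n) x else []) ⊨ᵛ φ
    selected true  = replicate-⊨ᵛ φ x m n
    selected false = id
  replicate-⊨ᵛ (X □→ φ)      x m n h =
    subst (_⊨ᵛ φ) (sym (map-replicate (update X) (suc n) x))
      (replicate-⊨ᵛ φ (update X x) m n (subst (_⊨ᵛ φ) (map-replicate (update X) (suc m) x) h))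

  update-cases : ∀ X → (∀ w → update X w ≡ w) ⊎ ∃[ x ] (∀ w → update X w ≡ x)
  update-cases X with X zero
  ... | nothing = inj₁ (λ _ → refl)
  ... | just x  = inj₂ (x , λ _ → refl)

  update-transfer : ∀ X φ {v vs w ws} → (v ∷ vs ⊨ᵛ φ → w ∷ ws ⊨ᵛ φ) →
                    map (update X) (v ∷ vs) ⊨ᵛ φ → map (update X) (w ∷ ws) ⊨ᵛ φ
  update-transfer X φ {v} {vs} {w} {ws} h with update-cases X
  ... | inj₁ fixes = subst (_⊨ᵛ φ) (sym (unchanged (w ∷ ws))) ∘ h ∘ subst (_⊨ᵛ φ) (unchanged (v ∷ vs))
    where
    unchanged : ∀ us → map (update X) us ≡ us
    unchanged us = trans (map-cong fixes us) (map-id us)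
  ... | inj₂ (x , constant) =
    subst (_⊨ᵛ φ) (sym (flattened (w ∷ ws))) ∘ replicate-⊨ᵛ φ x (length vs) (length ws) ∘
    subst (_⊨ᵛ φ) (flattened (v ∷ vs))
    where
    flattened : ∀ us → map (update X) us ≡ replicate (length us) x
    flattened us = trans (map-cong constant us) (map-const x us)

  probᵛ-padded : ∀ α w ws x k →
                 probᵛ ((w ∷ ws) ++ replicate k x) α ≡ + (count α (w ∷ ws) + count α [ x ] * k) / suc (length ws + k)
  probᵛ-padded α w ws x k = ℚP./-cong
    (cong +_ (trans (length-select-++ ⟦ α ⟧ (w ∷ ws) (replicate k x))
                    (cong (_+_ (count α (w ∷ ws))) (length-select-replicate ⟦ α ⟧ k x))))
    (cong suc (trans (length-++ ws) (cong (_+_ (length ws)) (length-replicate k))))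

open OneVariable 2

w₀ w₁ w₂ : Val
w₀ = zero
w₁ = suc zero
w₂ = suc (suc zero)

headA headB : List Val
headA = w₀ ∷ w₁ ∷ w₁ ∷ []
headB = w₀ ∷ w₁ ∷ w₁ ∷ w₁ ∷ []

A B : ℕ → List Val
A k = headA ++ replicate k w₂
B k = headB ++ replicate k w₂

-- 0, 1, 2, 3 ↦ 0, 1, 3, 4: how a count on w₀ w₁ w₁ changes when w₁ is tripled
stretch : ℕ → ℕ
stretch a = a + ⌊ a /2⌋

stretch-mono-≤ : ∀ {a a′} → a ≤ a′ → stretch a ≤ stretch a′
stretch-mono-≤ h = +-mono-≤ h (⌊n/2⌋-mono h)

stretch-mono-< : ∀ {a a′} → a < a′ → stretch a < stretch a′
stretch-mono-< h = +-mono-<-≤ h (⌊n/2⌋-mono (<⇒≤ h))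

1*q*m≡m*q : ∀ q m → 1 * q * m ≡ m * q
1*q*m≡m*q q m = trans (cong (_* m) (*-identityˡ q)) (*-comm q m)

-- The high digits p and c * q agree only when the threshold p/q is the limit value c ∈ {0, 1}.
threshold-premise-≤ : ∀ {p q a c} .{{_ : NonZero q}} → c ≤ 1 → p ≡ c * q →
                      p * 3 ≤ a * q → p * 4 ≤ stretch a * q
threshold-premise-≤ z≤n refl _ = z≤n
threshold-premise-≤ {q = q} {a} (s≤s z≤n) refl h =
  subst (_≤ stretch a * q) (sym (1*q*m≡m*q q 4)) (*-monoˡ-≤ q (stretch-mono-≤ 3≤a))
  where
  3≤a : 3 ≤ a
  3≤a = *-cancelʳ-≤ 3 a q (subst (_≤ a * q) (1*q*m≡m*q q 3) h)

threshold-premise-< : ∀ {p q a c} .{{_ : NonZero q}} → c ≤ 1 → p ≡ c * q →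
                      p * 3 < a * q → p * 4 < stretch a * q
threshold-premise-< {q = q} {a} z≤n refl h = <-≤-trans h (*-monoˡ-≤ q (m≤m+n a ⌊ a /2⌋))
threshold-premise-< {q = q} {a} (s≤s z≤n) refl h =
  subst (_< stretch a * q) (sym (1*q*m≡m*q q 4)) (*-monoˡ-< q (stretch-mono-< 3<a))
  where
  3<a : 3 < a
  3<a = *-cancelʳ-< q 3 a (subst (_< a * q) (1*q*m≡m*q q 3) h)

threshold-bounds : ∀ {p q a k} → a ≤ 3 → 3 * q + p * 4 < k → a * q < k × p * 4 < k
threshold-bounds {p} {q} a≤3 bound =
  ≤-<-trans (≤-trans (*-monoˡ-≤ q a≤3) (m≤m+n (3 * q) (p * 4))) bound ,
  ≤-<-trans (m≤n+m (p * 4) (3 * q)) bound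

threshold-≤ : ∀ {p q a c k} .{{_ : NonZero q}} → c ≤ 1 → a ≤ 3 → 3 * q + p * 4 < k →
              p * (3 + k) ≤ (a + c * k) * q → p * (4 + k) ≤ (stretch a + c * k) * q
threshold-≤ {p} {q} {a} {c} {k} c≤1 a≤3 bound h =
  subst₂ _≤_ (sym (*-distribˡ-+ p 4 k)) (sym (two-digit-*ʳ (stretch a) c k q))
    (digits-≤-transfer {c = p} {c * q} (proj₁ bounds) (proj₂ bounds) (threshold-premise-≤ {p} {q} {a} c≤1)
      (subst₂ _≤_ (*-distribˡ-+ p 3 k) (two-digit-*ʳ a c k q) h))
  where bounds = threshold-bounds {p} {q} a≤3 bound

threshold-< : ∀ {p q a c k} .{{_ : NonZero q}} → c ≤ 1 → a ≤ 3 → 3 * q + p * 4 < k →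
              p * (3 + k) < (a + c * k) * q → p * (4 + k) < (stretch a + c * k) * q
threshold-< {p} {q} {a} {c} {k} c≤1 a≤3 bound h =
  subst₂ _<_ (sym (*-distribˡ-+ p 4 k)) (sym (two-digit-*ʳ (stretch a) c k q))
    (digits-<-transfer {c = p} {c * q} (proj₁ bounds) (proj₂ bounds) (threshold-premise-< {p} {q} {a} c≤1)
      (subst₂ _<_ (*-distribˡ-+ p 3 k) (two-digit-*ʳ a c k q) h))
  where bounds = threshold-bounds {p} {q} a≤3 bound

comparison-≤ : ∀ {aβ aα cβ cα k} → aβ ≤ 3 → aα ≤ 3 → 5 ≤ k →
               (aβ + cβ * k) * (3 + k) ≤ (aα + cα * k) * (3 + k) →
               (stretch aβ + cβ * k) * (4 + k) ≤ (stretch aα + cα * k) * (4 + k)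
comparison-≤ {aβ} {aα} {cβ} {cα} {k} aβ≤3 aα≤3 5≤k h = *-monoˡ-≤ (4 + k)
  (digits-≤-transfer {aβ} {aα} {c = cβ} {cα} (below-k (m≤n⇒m≤1+n aα≤3)) (below-k (stretch-mono-≤ aβ≤3))
    (λ _ → stretch-mono-≤) (*-cancelʳ-≤ _ _ (3 + k) h))
  where
  below-k : ∀ {x} → x ≤ 4 → x < k
  below-k x≤4 = <-≤-trans (s≤s x≤4) 5≤k

comparison-< : ∀ {aβ aα cβ cα k} → aβ ≤ 3 → aα ≤ 3 → 5 ≤ k →
               (aβ + cβ * k) * (3 + k) < (aα + cα * k) * (3 + k) →
               (stretch aβ + cβ * k) * (4 + k) < (stretch aα + cα * k) * (4 + k)
comparison-< {aβ} {aα} {cβ} {cα} {k} aβ≤3 aα≤3 5≤k h = *-monoˡ-< (4 + k)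
  (digits-<-transfer {aβ} {aα} {c = cβ} {cα} (below-k (m≤n⇒m≤1+n aα≤3)) (below-k (stretch-mono-≤ aβ≤3))
    (λ _ → stretch-mono-<) (*-cancelʳ-< (3 + k) _ _ h))
  where
  below-k : ∀ {x} → x ≤ 4 → x < k
  below-k x≤4 = <-≤-trans (s≤s x≤4) 5≤k

low high : CO σ₁ → ℕ
low α  = count α headA
high α = count α [ w₂ ]

low≤3 : ∀ α → low α ≤ 3
low≤3 α = length-select-≤ ⟦ α ⟧ headA

high≤1 : ∀ α → high α ≤ 1
high≤1 α = length-select-≤ ⟦ α ⟧ [ w₂ ]

count-headB : ∀ α → count α headB ≡ stretch (low α)
count-headB α with ⟦ α ⟧ w₀ | ⟦ α ⟧ w₁
... | false | false = refl
... | false | true  = refl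
... | true  | false = refl
... | true  | true  = refl

probᵛ-A : ∀ α k → probᵛ (A k) α ≡ + (low α + high α * k) / (3 + k)
probᵛ-A α k = probᵛ-padded α w₀ (w₁ ∷ w₁ ∷ []) w₂ k

probᵛ-B : ∀ α k → probᵛ (B k) α ≡ + (stretch (low α) + high α * k) / (4 + k)
probᵛ-B α k = trans (probᵛ-padded α w₀ (w₁ ∷ w₁ ∷ w₁ ∷ []) w₂ k)
                    (ℚP./-cong (cong (λ b → + (b + high α * k)) (count-headB α)) refl)

Pr≥-transfer : ∀ α ε → 0ℚ ℚ.≤ ε → Eventually (λ k → ε ℚ.≤ probᵛ (A k) α → ε ℚ.≤ probᵛ (B k) α)
Pr≥-transfer α ε@(mkℚ (+ p) d _) _ = suc (3 * suc d + p * 4) , λ {k} bound h →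
  subst₂ ℚ._≤_ (ℚP.↥p/↧p≡p ε) (sym (probᵛ-B α k))
    (from (/≤/⇔ p d (stretch (low α) + high α * k) (3 + k))
      (threshold-≤ {p} {suc d} {low α} {high α} {k} (high≤1 α) (low≤3 α) bound
        (to (/≤/⇔ p d (low α + high α * k) (2 + k))
          (subst₂ ℚ._≤_ (sym (ℚP.↥p/↧p≡p ε)) (probᵛ-A α k) h))))
Pr≥-transfer α (mkℚ -[1+ _ ] _ _) (ℚ.*≤* ())

Pr>-transfer : ∀ α ε → 0ℚ ℚ.≤ ε → Eventually (λ k → ε ℚ.< probᵛ (A k) α → ε ℚ.< probᵛ (B k) α)
Pr>-transfer α ε@(mkℚ (+ p) d _) _ = suc (3 * suc d + p * 4) , λ {k} bound h →
  subst₂ ℚ._<_ (ℚP.↥p/↧p≡p ε) (sym (probᵛ-B α k))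
    (from (/</⇔ p d (stretch (low α) + high α * k) (3 + k))
      (threshold-< {p} {suc d} {low α} {high α} {k} (high≤1 α) (low≤3 α) bound
        (to (/</⇔ p d (low α + high α * k) (2 + k))
          (subst₂ ℚ._<_ (sym (ℚP.↥p/↧p≡p ε)) (probᵛ-A α k) h))))
Pr>-transfer α (mkℚ -[1+ _ ] _ _) (ℚ.*≤* ())

Pr≥Pr-transfer : ∀ α β {k} → 5 ≤ k →
                 probᵛ (A k) β ℚ.≤ probᵛ (A k) α → probᵛ (B k) β ℚ.≤ probᵛ (B k) α
Pr≥Pr-transfer α β {k} 5≤k h = subst₂ ℚ._≤_ (sym (probᵛ-B β k)) (sym (probᵛ-B α k))
  (from (/≤/⇔ (stretch (low β) + high β * k) (3 + k) (stretch (low α) + high α * k) (3 + k))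
    (comparison-≤ {low β} {low α} {high β} {high α} {k} (low≤3 β) (low≤3 α) 5≤k
      (to (/≤/⇔ (low β + high β * k) (2 + k) (low α + high α * k) (2 + k))
        (subst₂ ℚ._≤_ (probᵛ-A β k) (probᵛ-A α k) h))))

Pr>Pr-transfer : ∀ α β {k} → 5 ≤ k →
                 probᵛ (A k) β ℚ.< probᵛ (A k) α → probᵛ (B k) β ℚ.< probᵛ (B k) α
Pr>Pr-transfer α β {k} 5≤k h = subst₂ ℚ._<_ (sym (probᵛ-B β k)) (sym (probᵛ-B α k))
  (from (/</⇔ (stretch (low β) + high β * k) (3 + k) (stretch (low α) + high α * k) (3 + k))
    (comparison-< {low β} {low α} {high β} {high α} {k} (low≤3 β) (low≤3 α) 5≤k
      (to (/</⇔ (low β + high β * k) (2 + k) (low α + high α * k) (2 + k))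
        (subst₂ ℚ._<_ (probᵛ-A β k) (probᵛ-A α k) h))))

A-not-constant : ∀ k v → ¬ (A k ⊨ᵛ eqˡ zero v)
A-not-constant k v h with trans (h w₀ (here refl)) (sym (h w₁ (there (here refl))))
... | ()

A-exhaustive : ∀ k v → v ∈ A (suc k)
A-exhaustive k zero             = here refl
A-exhaustive k (suc zero)       = there (here refl)
A-exhaustive k (suc (suc zero)) = there (there (there (here refl)))

A-not-avoiding : ∀ k v → ¬ (A (suc k) ⊨ᵛ neqˡ zero v)
A-not-avoiding k v h = h v (A-exhaustive k v) refl

transfer : ∀ ψ → NoSel ψ → Eventually (λ k → A k ⊨ᵛ ψ → B k ⊨ᵛ ψ)
transfer (eqˡ zero v)   _ = 0 , λ {k} _ → ⊥-elim ∘ A-not-constant k v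
transfer (neqˡ zero v)  _ = 1 , λ { {suc k} _ → ⊥-elim ∘ A-not-avoiding k v }
transfer (Pr≥ α ε 0≤ε _) _ = Pr≥-transfer α ε 0≤ε
transfer (Pr> α ε 0≤ε _) _ = Pr>-transfer α ε 0≤ε
transfer (Pr≥Pr α β)    _ = 5 , Pr≥Pr-transfer α β
transfer (Pr>Pr α β)    _ = 5 , Pr>Pr-transfer α β
transfer (φ ∧ᵖ ψ) (φ-noSel , ψ-noSel) =
  eventually-map (λ (f , g) (hφ , hψ) → f hφ , g hψ) (eventually-× (transfer φ φ-noSel) (transfer ψ ψ-noSel))
transfer (φ ⊔ ψ) (φ-noSel , ψ-noSel) =
  eventually-map (λ (f , g) → Sum.map f g) (eventually-× (transfer φ φ-noSel) (transfer ψ ψ-noSel))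
transfer (X □→ φ) φ-noSel = eventually-map (update-transfer X φ) (transfer φ φ-noSel)

⅓ : ℚ
⅓ = + 1 / 3

Pr[w₀]≥⅓ : PCO σ₁
Pr[w₀]≥⅓ = Pr≥ (eq zero w₀) ⅓ (from (/≤/⇔ 0 0 1 2) z≤n) (from (/≤/⇔ 1 2 1 0) (s≤s z≤n))

φ₀ : PCO σ₁
φ₀ = neq zero w₂ ⊃ Pr[w₀]≥⅓

select-≠w₂-replicate : ∀ k → select ⟦ neq zero w₂ ⟧ (replicate k w₂) ≡ []
select-≠w₂-replicate k = select-replicate ⟦ neq zero w₂ ⟧ k w₂

A⊨φ₀ : ∀ k → A k ⊨ᵛ φ₀
A⊨φ₀ k = subst (λ ws → headA ++ ws ⊨ᵛ Pr[w₀]≥⅓) (sym (select-≠w₂-replicate k)) ℚP.≤-refl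

B⊭φ₀ : ∀ k → ¬ (B k ⊨ᵛ φ₀)
B⊭φ₀ k h = <⇒≱ (n<1+n 3)
  (to (/≤/⇔ 1 2 1 3) (subst (λ ws → headB ++ ws ⊨ᵛ Pr[w₀]≥⅓) (select-≠w₂-replicate k) h))

PCO≰P□→ : ¬ (PCOᴸ ≤ᴸ P□→ᴸ)
PCO≰P□→ PCO≤P□→ with PCO≤P□→ σ₁ φ₀ tt
... | ψ , ψ-noSel , φ₀≡ψ with transfer ψ ψ-noSel
... | K , A⊨ψ⇒B⊨ψ = B⊭φ₀ K (from (φ₀⇔ψ (B K)) (A⊨ψ⇒B⊨ψ ≤-refl (to (φ₀⇔ψ (A K)) (A⊨φ₀ K))))
  where φ₀⇔ψ = ≡ᶠ⇒⊨ᵛ⇔ {φ₀} {ψ} φ₀≡ψ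

corollary3 : P□→ᴸ <ᴸ PCOᴸ
corollary3 = (λ _ φ _ → φ , tt , λ _ _ → id , id) , PCO≰P□→
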